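{- Let $1\le k\le n$. The weight vector of any $(n,k)$-homogeneous subcube partition is $\left(\binom{k}{0},\binom{k}{1},\dots,\binom{k}{k},0,\dots,0\right)$ (of length $n+1$).
   Context: Subcubes of $\{0,1\}^n$ are identified with words in $\{0,1,*\}^n$; the codimension is the number of non-$*$ positions, and the weight is the number of $1$s. A subcube partition of length $n$ is a partition of $\{0,1\}^n$ into subcubes; it is tight if for every coordinate $i$ some subcube $s$ has $s_i\ne*$. An $(n,k)$-homogeneous subcube partition is a tight subcube partition of length $n$ all of whose subcubes have codimension $k$. The weight vector of $F$ is $(w_0,\dots,w_n)$ where $w_h$ is the number of subcubes of $F$ of weight $h$. -}

module Defs where

open import Data.Nat using (ℕ; zero; suc; _+_)
open import Data.Bool using (Bool; true; false)
open import Data.Fin using (Fin)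
open import Data.Vec using (Vec; lookup)
open import Data.List using (List; length; filter)
open import Data.List.Membership.Propositional using (_∈_)
open import Data.Product using (Σ; ∃; _×_; _,_)
open import Relation.Binary.PropositionalEquality using (_≡_; _≢_)
open import Relation.Nullary using (Dec; yes; no; ¬_)
open import Data.Nat.Combinatorics using (_C_)
open import Data.Nat.Properties using (_≟_)

data Sym : Set where
  s0 s1 star : Sym

Subcube : ℕ → Set
Subcube n = Vec Sym n

symMatch : Bool → Sym → Set
symMatch false s0 = Data.Unit.⊤ where import Data.Unit
symMatch true  s1 = Data.Unit.⊤ where import Data.Unit
symMatch _     star = Data.Unit.⊤ where import Data.Unit
symMatch false s1 = Data.Empty.⊥ where import Data.Empty
symMatch true  s0 = Data.Empty.⊥ where import Data.Empty

_∈C_ : ∀ {n} → Vec Bool n → Subcube n → Set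
_∈C_ {n} x s = (i : Fin n) → symMatch (lookup x i) (lookup s i)

isFixed : Sym → ℕ
isFixed star = 0
isFixed _    = 1

codim : ∀ {n} → Subcube n → ℕ
codim Vec.[] = 0 where import Data.Vec as Vec
codim (a Vec.∷ s) = isFixed a + codim s where import Data.Vec as Vec

isOne : Sym → ℕ
isOne s1 = 1
isOne _  = 0

weight : ∀ {n} → Subcube n → ℕ
weight Vec.[] = 0 where import Data.Vec as Vec
weight (a Vec.∷ s) = isOne a + weight s where import Data.Vec as Vec

-- A subcube partition of length n, given as a finite list of subcubes:
-- every point of {0,1}^n lies in exactly one entry of the list
-- (exactly one list position, so no subcube is repeated).
IsPartition : ∀ {n} → List (Subcube n) → Set
IsPartition {n} F =
  (x : Vec Bool n) →
    Σ (Fin (length F)) λ j →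
      (x ∈C Data.List.lookup F j) ×
      ((j' : Fin (length F)) → x ∈C Data.List.lookup F j' → j' ≡ j)
  where import Data.List

IsTight : ∀ {n} → List (Subcube n) → Set
IsTight {n} F = (i : Fin n) → ∃ λ s → (s ∈ F) × (lookup s i ≢ star)

IsHomogeneous : (n k : ℕ) → List (Subcube n) → Set
IsHomogeneous n k F =
  IsPartition F × IsTight F × ((s : Subcube n) → s ∈ F → codim s ≡ k)

weightCount : ∀ {n} → List (Subcube n) → ℕ → ℕ
weightCount F h = length (filter (λ s → weight s ≟ h) F)

weightVector : ∀ {n} → List (Subcube n) → Fin (suc n) → ℕ
weightVector F h = weightCount F (Data.Fin.toℕ h) where import Data.Fin

-- Give each point x of {0,1}ⁿ the mass a^|x|, where |x| is its number of ones.
-- The whole cube has mass (1+a)ⁿ, and a subcube of weight w and codimension k has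
-- mass aʷ(1+a)ⁿ⁻ᵏ.  As F partitions the cube, Σ_{s∈F} a^(weight s) = (1+a)ᵏ for
-- every natural a, i.e. Σ_h w_h aʰ = Σ_h (k choose h) aʰ.  Evaluating at a base a
-- larger than every coefficient, the two sides are base-a expansions, so their
-- digits w_h and (k choose h) agree.
module Submission where

open import Defs
open import Data.Nat using (ℕ; suc; _≤_)
open import Data.Fin using (Fin; toℕ)
import Data.Fin as Fin
open import Data.List using (List)
open import Data.Nat.Combinatorics using (_C_)
open import Relation.Binary.PropositionalEquality using (_≡_)

open import Function using (_∘_)
open import Data.Nat using (zero; _+_; _*_; _^_; _<_; z≤n; s≤s; _≡ᵇ_)
open import Data.Nat.Properties
  using (_≟_; +-comm; +-identityʳ; +-cancelˡ-≡; *-comm; *-assoc; *-identityˡ; *-zeroʳ;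
         *-distribˡ-+; *-distribʳ-+; *-cancelˡ-≡; *-cancelʳ-≡; m^n≢0; ≤-trans; ≤-reflexive;
         m≤m+n; m≤n+m; m≤n⇒m≤1+n; +-commutativeSemigroup; *-commutativeSemigroup)
open import Data.Nat.DivMod using (_%_; [m+kn]%n≡m%n; m<n⇒m%n≡m)
open import Data.Nat.Combinatorics using (nCk+nC[k+1]≡[n+1]C[k+1])
open import Algebra.Properties.CommutativeSemigroup *-commutativeSemigroup
  using () renaming (x∙yz≈y∙xz to *-leftComm)
open import Algebra.Properties.CommutativeSemigroup +-commutativeSemigroup
  using () renaming (interchange to +-interchange)
open import Data.Bool using (Bool; true; false; if_then_else_)
open import Data.Vec using (Vec; []; _∷_)
open import Data.List using ([]; _∷_; length; lookup)
open import Data.List.Membership.Propositional using (_∈_)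
open import Data.List.Relation.Unary.Any using (here; there)
import Data.Fin.Properties as Finₚ
open import Data.Product using (_×_; _,_)
open import Data.Empty using (⊥-elim)
open import Data.Unit using (tt)
open import Relation.Nullary using (¬_; does)
open import Relation.Binary.PropositionalEquality
  using (refl; sym; trans; cong; cong₂; module ≡-Reasoning)

open ≡-Reasoning

sumPoints : ∀ n → (Vec Bool n → ℕ) → ℕ
sumPoints zero    f = f []
sumPoints (suc n) f = sumPoints n (λ x → f (true ∷ x)) + sumPoints n (λ x → f (false ∷ x))

sumPoints-cong : ∀ n {f g : Vec Bool n → ℕ} → (∀ x → f x ≡ g x) →
  sumPoints n f ≡ sumPoints n g
sumPoints-cong zero    f≡g = f≡g []
sumPoints-cong (suc n) f≡g =
  cong₂ _+_ (sumPoints-cong n (f≡g ∘ (true ∷_))) (sumPoints-cong n (f≡g ∘ (false ∷_)))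

sumPoints-zero : ∀ n → sumPoints n (λ _ → 0) ≡ 0
sumPoints-zero zero    = refl
sumPoints-zero (suc n) = cong₂ _+_ (sumPoints-zero n) (sumPoints-zero n)

sumPoints-+ : ∀ n (f g : Vec Bool n → ℕ) →
  sumPoints n (λ x → f x + g x) ≡ sumPoints n f + sumPoints n g
sumPoints-+ zero    f g = refl
sumPoints-+ (suc n) f g = begin
  sumPoints n (λ x → f (true ∷ x) + g (true ∷ x)) + sumPoints n (λ x → f (false ∷ x) + g (false ∷ x))
    ≡⟨ cong₂ _+_ (sumPoints-+ n _ _) (sumPoints-+ n _ _) ⟩
  (sumPoints n (f ∘ (true ∷_)) + sumPoints n (g ∘ (true ∷_))) +
  (sumPoints n (f ∘ (false ∷_)) + sumPoints n (g ∘ (false ∷_)))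
    ≡⟨ +-interchange (sumPoints n (f ∘ (true ∷_))) _ _ _ ⟩
  sumPoints (suc n) f + sumPoints (suc n) g ∎

sumPoints-*ˡ : ∀ n c (f : Vec Bool n → ℕ) → sumPoints n (λ x → c * f x) ≡ c * sumPoints n f
sumPoints-*ˡ zero    c f = refl
sumPoints-*ˡ (suc n) c f =
  trans (cong₂ _+_ (sumPoints-*ˡ n c _) (sumPoints-*ˡ n c _)) (sym (*-distribˡ-+ c _ _))

sumList : {A : Set} → List A → (A → ℕ) → ℕ
sumList []      f = 0
sumList (s ∷ F) f = f s + sumList F f

sumList-cong : {A : Set} (F : List A) {f g : A → ℕ} → (∀ s → s ∈ F → f s ≡ g s) →
  sumList F f ≡ sumList F g
sumList-cong []      f≡g = refl
sumList-cong (s ∷ F) f≡g =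
  cong₂ _+_ (f≡g s (here refl)) (sumList-cong F (λ t t∈F → f≡g t (there t∈F)))

sumList-*ʳ : {A : Set} (F : List A) (f : A → ℕ) (c : ℕ) → sumList F f * c ≡ sumList F (λ s → f s * c)
sumList-*ʳ []      f c = refl
sumList-*ʳ (s ∷ F) f c = trans (*-distribʳ-+ c (f s) _) (cong (f s * c +_) (sumList-*ʳ F f c))

sumPoints-sumList-comm : ∀ n {A : Set} (F : List A) (g : Vec Bool n → A → ℕ) →
  sumPoints n (λ x → sumList F (g x)) ≡ sumList F (λ s → sumPoints n (λ x → g x s))
sumPoints-sumList-comm n []      g = sumPoints-zero n
sumPoints-sumList-comm n (s ∷ F) g =
  trans (sumPoints-+ n _ _) (cong (sumPoints n (λ x → g x s) +_) (sumPoints-sumList-comm n F g))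

indicator : ∀ {n} → Vec Bool n → Subcube n → ℕ
indicator []          []       = 1
indicator (true ∷ x)  (s0 ∷ s) = 0
indicator (false ∷ x) (s1 ∷ s) = 0
indicator (_ ∷ x)     (_ ∷ s)  = indicator x s

∈C-∷ : ∀ {n b c} {x : Vec Bool n} {s : Subcube n} → symMatch b c → x ∈C s → (b ∷ x) ∈C (c ∷ s)
∈C-∷ b∈c x∈s Fin.zero    = b∈c
∈C-∷ b∈c x∈s (Fin.suc i) = x∈s i

indicator-∈ : ∀ {n} (x : Vec Bool n) (s : Subcube n) → x ∈C s → indicator x s ≡ 1
indicator-∈ []          []         _   = refl
indicator-∈ (true ∷ x)  (s0 ∷ s)   x∈s = ⊥-elim (x∈s Fin.zero)
indicator-∈ (true ∷ x)  (s1 ∷ s)   x∈s = indicator-∈ x s (x∈s ∘ Fin.suc)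
indicator-∈ (true ∷ x)  (star ∷ s) x∈s = indicator-∈ x s (x∈s ∘ Fin.suc)
indicator-∈ (false ∷ x) (s0 ∷ s)   x∈s = indicator-∈ x s (x∈s ∘ Fin.suc)
indicator-∈ (false ∷ x) (s1 ∷ s)   x∈s = ⊥-elim (x∈s Fin.zero)
indicator-∈ (false ∷ x) (star ∷ s) x∈s = indicator-∈ x s (x∈s ∘ Fin.suc)

indicator-∉ : ∀ {n} (x : Vec Bool n) (s : Subcube n) → ¬ x ∈C s → indicator x s ≡ 0
indicator-∉ []          []         x∉s = ⊥-elim (x∉s (λ ()))
indicator-∉ (true ∷ x)  (s0 ∷ s)   x∉s = refl
indicator-∉ (true ∷ x)  (s1 ∷ s)   x∉s = indicator-∉ x s (x∉s ∘ ∈C-∷ tt)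
indicator-∉ (true ∷ x)  (star ∷ s) x∉s = indicator-∉ x s (x∉s ∘ ∈C-∷ tt)
indicator-∉ (false ∷ x) (s0 ∷ s)   x∉s = indicator-∉ x s (x∉s ∘ ∈C-∷ tt)
indicator-∉ (false ∷ x) (s1 ∷ s)   x∉s = refl
indicator-∉ (false ∷ x) (star ∷ s) x∉s = indicator-∉ x s (x∉s ∘ ∈C-∷ tt)

sumList-indicator-none : ∀ {n} (F : List (Subcube n)) (x : Vec Bool n) →
  (∀ j → ¬ x ∈C lookup F j) → sumList F (indicator x) ≡ 0
sumList-indicator-none []      x x∉F = refl
sumList-indicator-none (s ∷ F) x x∉F =
  cong₂ _+_ (indicator-∉ x s (x∉F Fin.zero)) (sumList-indicator-none F x (x∉F ∘ Fin.suc))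

sumList-indicator-unique : ∀ {n} (F : List (Subcube n)) (x : Vec Bool n) (j : Fin (length F)) →
  x ∈C lookup F j → (∀ j′ → x ∈C lookup F j′ → j′ ≡ j) → sumList F (indicator x) ≡ 1
sumList-indicator-unique (s ∷ F) x Fin.zero x∈s unique =
  cong₂ _+_ (indicator-∈ x s x∈s)
    (sumList-indicator-none F x (λ j′ x∈F → Finₚ.0≢1+n (sym (unique (Fin.suc j′) x∈F))))
sumList-indicator-unique (s ∷ F) x (Fin.suc j) x∈F unique =
  cong₂ _+_ (indicator-∉ x s (λ x∈s → Finₚ.0≢1+n (unique Fin.zero x∈s)))
    (sumList-indicator-unique F x j x∈F (λ j′ x∈F′ → Finₚ.suc-injective (unique (Fin.suc j′) x∈F′)))

partition⇒sumList-indicator≡1 : ∀ {n} (F : List (Subcube n)) → IsPartition F →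
  ∀ x → sumList F (indicator x) ≡ 1
partition⇒sumList-indicator≡1 F partition x =
  let (j , x∈F , unique) = partition x in sumList-indicator-unique F x j x∈F unique

pointMass : ℕ → ∀ {n} → Vec Bool n → ℕ
pointMass a []          = 1
pointMass a (true ∷ x)  = a * pointMass a x
pointMass a (false ∷ x) = pointMass a x

cubeMass : ℕ → ∀ {n} → Subcube n → ℕ
cubeMass a []         = 1
cubeMass a (s0 ∷ s)   = cubeMass a s
cubeMass a (s1 ∷ s)   = a * cubeMass a s
cubeMass a (star ∷ s) = a * cubeMass a s + cubeMass a s

sumPoints-pointMass : ∀ n a → sumPoints n (pointMass a) ≡ suc a ^ n
sumPoints-pointMass zero    a = refl
sumPoints-pointMass (suc n) a = begin
  sumPoints n (λ x → a * pointMass a x) + sumPoints n (pointMass a)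
    ≡⟨ cong (_+ sumPoints n (pointMass a)) (sumPoints-*ˡ n a (pointMass a)) ⟩
  a * sumPoints n (pointMass a) + sumPoints n (pointMass a)
    ≡⟨ cong (λ m → a * m + m) (sumPoints-pointMass n a) ⟩
  a * suc a ^ n + suc a ^ n
    ≡⟨ +-comm (a * suc a ^ n) _ ⟩
  suc a ^ (suc n) ∎

sumPoints-*-inner : ∀ n c (f g : Vec Bool n → ℕ) →
  sumPoints n (λ x → f x * (c * g x)) ≡ c * sumPoints n (λ x → f x * g x)
sumPoints-*-inner n c f g =
  trans (sumPoints-cong n (λ x → *-leftComm (f x) c (g x))) (sumPoints-*ˡ n c _)

sumPoints-indicator-pointMass : ∀ n a (s : Subcube n) →
  sumPoints n (λ x → indicator x s * pointMass a x) ≡ cubeMass a s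
sumPoints-indicator-pointMass zero    a []         = refl
sumPoints-indicator-pointMass (suc n) a (s0 ∷ s)   =
  cong₂ _+_ (sumPoints-zero n) (sumPoints-indicator-pointMass n a s)
sumPoints-indicator-pointMass (suc n) a (s1 ∷ s)   = begin
  sumPoints n (λ x → indicator x s * (a * pointMass a x)) + sumPoints n (λ _ → 0)
    ≡⟨ cong₂ _+_ (sumPoints-*-inner n a (λ x → indicator x s) (pointMass a)) (sumPoints-zero n) ⟩
  a * sumPoints n (λ x → indicator x s * pointMass a x) + 0
    ≡⟨ +-identityʳ _ ⟩
  a * sumPoints n (λ x → indicator x s * pointMass a x)
    ≡⟨ cong (a *_) (sumPoints-indicator-pointMass n a s) ⟩
  a * cubeMass a s ∎
sumPoints-indicator-pointMass (suc n) a (star ∷ s) = begin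
  sumPoints n (λ x → indicator x s * (a * pointMass a x)) + sumPoints n (λ x → indicator x s * pointMass a x)
    ≡⟨ cong₂ _+_ (sumPoints-*-inner n a (λ x → indicator x s) (pointMass a)) refl ⟩
  a * sumPoints n (λ x → indicator x s * pointMass a x) + sumPoints n (λ x → indicator x s * pointMass a x)
    ≡⟨ cong (λ m → a * m + m) (sumPoints-indicator-pointMass n a s) ⟩
  a * cubeMass a s + cubeMass a s ∎

cubeMass-*-codim : ∀ {n} a (s : Subcube n) →
  cubeMass a s * suc a ^ codim s ≡ a ^ weight s * suc a ^ n

cubeMass-*-suc-codim : ∀ {n} a (s : Subcube n) →
  cubeMass a s * suc a ^ suc (codim s) ≡ a ^ weight s * suc a ^ suc n
cubeMass-*-suc-codim {n} a s = begin
  cubeMass a s * (suc a * suc a ^ codim s)  ≡⟨ *-leftComm (cubeMass a s) (suc a) _ ⟩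
  suc a * (cubeMass a s * suc a ^ codim s)  ≡⟨ cong (suc a *_) (cubeMass-*-codim a s) ⟩
  suc a * (a ^ weight s * suc a ^ n)        ≡⟨ *-leftComm (suc a) (a ^ weight s) _ ⟩
  a ^ weight s * (suc a * suc a ^ n)        ∎

cubeMass-*-codim a []         = refl
cubeMass-*-codim a (s0 ∷ s)   = cubeMass-*-suc-codim a s
cubeMass-*-codim {suc n} a (s1 ∷ s) = begin
  (a * cubeMass a s) * suc a ^ suc (codim s)  ≡⟨ *-assoc a (cubeMass a s) _ ⟩
  a * (cubeMass a s * suc a ^ suc (codim s))  ≡⟨ cong (a *_) (cubeMass-*-suc-codim a s) ⟩
  a * (a ^ weight s * suc a ^ suc n)          ≡⟨ *-assoc a (a ^ weight s) _ ⟨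
  (a * a ^ weight s) * suc a ^ suc n          ∎
cubeMass-*-codim {suc n} a (star ∷ s) = begin
  (a * cubeMass a s + cubeMass a s) * suc a ^ codim s  ≡⟨ cong (_* suc a ^ codim s) (+-comm (a * cubeMass a s) (cubeMass a s)) ⟩
  (suc a * cubeMass a s) * suc a ^ codim s             ≡⟨ *-assoc (suc a) (cubeMass a s) _ ⟩
  suc a * (cubeMass a s * suc a ^ codim s)             ≡⟨ cong (suc a *_) (cubeMass-*-codim a s) ⟩
  suc a * (a ^ weight s * suc a ^ n)                   ≡⟨ *-leftComm (suc a) (a ^ weight s) _ ⟩
  a ^ weight s * (suc a * suc a ^ n)                   ∎

partition⇒sumList-cubeMass : ∀ {n} (F : List (Subcube n)) → IsPartition F →
  ∀ a → sumList F (cubeMass a) ≡ suc a ^ n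
partition⇒sumList-cubeMass {n} F partition a = begin
  sumList F (cubeMass a)
    ≡⟨ sumList-cong F (λ s _ → sumPoints-indicator-pointMass n a s) ⟨
  sumList F (λ s → sumPoints n (λ x → indicator x s * pointMass a x))
    ≡⟨ sumPoints-sumList-comm n F (λ x s → indicator x s * pointMass a x) ⟨
  sumPoints n (λ x → sumList F (λ s → indicator x s * pointMass a x))
    ≡⟨ sumPoints-cong n (λ x → sumList-*ʳ F (indicator x) (pointMass a x)) ⟨
  sumPoints n (λ x → sumList F (indicator x) * pointMass a x)
    ≡⟨ sumPoints-cong n covered-once ⟩
  sumPoints n (pointMass a)
    ≡⟨ sumPoints-pointMass n a ⟩
  suc a ^ n ∎
  where
  covered-once : ∀ x → sumList F (indicator x) * pointMass a x ≡ pointMass a x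
  covered-once x = trans (cong (_* pointMass a x) (partition⇒sumList-indicator≡1 F partition x))
                         (*-identityˡ (pointMass a x))

homogeneous⇒weightEnumerator : ∀ {n k} (F : List (Subcube n)) → IsPartition F →
  (∀ s → s ∈ F → codim s ≡ k) → ∀ a → sumList F (λ s → a ^ weight s) ≡ suc a ^ k
homogeneous⇒weightEnumerator {n} {k} F partition codim≡k a =
  *-cancelʳ-≡ _ _ (suc a ^ n) {{m^n≢0 (suc a) n}} (begin
    sumList F (λ s → a ^ weight s) * suc a ^ n
      ≡⟨ sumList-*ʳ F _ _ ⟩
    sumList F (λ s → a ^ weight s * suc a ^ n)
      ≡⟨ sumList-cong F cubeMass-*-k ⟨
    sumList F (λ s → cubeMass a s * suc a ^ k)
      ≡⟨ sumList-*ʳ F (cubeMass a) _ ⟨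
    sumList F (cubeMass a) * suc a ^ k
      ≡⟨ cong (_* suc a ^ k) (partition⇒sumList-cubeMass F partition a) ⟩
    suc a ^ n * suc a ^ k
      ≡⟨ *-comm (suc a ^ n) _ ⟩
    suc a ^ k * suc a ^ n ∎)
  where
  cubeMass-*-k : ∀ s → s ∈ F → cubeMass a s * suc a ^ k ≡ a ^ weight s * suc a ^ n
  cubeMass-*-k s s∈F = trans (cong (λ c → cubeMass a s * suc a ^ c) (sym (codim≡k s s∈F)))
                             (cubeMass-*-codim a s)

evalPoly : (ℕ → ℕ) → ℕ → ℕ → ℕ
evalPoly c zero    a = 0
evalPoly c (suc N) a = c 0 + a * evalPoly (c ∘ suc) N a

evalPoly-cong : ∀ N {c d : ℕ → ℕ} a → (∀ h → c h ≡ d h) → evalPoly c N a ≡ evalPoly d N a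
evalPoly-cong zero    a c≡d = refl
evalPoly-cong (suc N) a c≡d = cong₂ _+_ (c≡d 0) (cong (a *_) (evalPoly-cong N a (c≡d ∘ suc)))

evalPoly-zero : ∀ N a → evalPoly (λ _ → 0) N a ≡ 0
evalPoly-zero zero    a = refl
evalPoly-zero (suc N) a = trans (cong (a *_) (evalPoly-zero N a)) (*-zeroʳ a)

evalPoly-+ : ∀ N (c d : ℕ → ℕ) a →
  evalPoly (λ h → c h + d h) N a ≡ evalPoly c N a + evalPoly d N a
evalPoly-+ zero    c d a = refl
evalPoly-+ (suc N) c d a = begin
  (c 0 + d 0) + a * evalPoly (λ h → c (suc h) + d (suc h)) N a
    ≡⟨ cong (λ m → (c 0 + d 0) + a * m) (evalPoly-+ N (c ∘ suc) (d ∘ suc) a) ⟩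
  (c 0 + d 0) + a * (evalPoly (c ∘ suc) N a + evalPoly (d ∘ suc) N a)
    ≡⟨ cong ((c 0 + d 0) +_) (*-distribˡ-+ a _ _) ⟩
  (c 0 + d 0) + (a * evalPoly (c ∘ suc) N a + a * evalPoly (d ∘ suc) N a)
    ≡⟨ +-interchange (c 0) (d 0) _ _ ⟩
  evalPoly c (suc N) a + evalPoly d (suc N) a ∎

δ : ℕ → ℕ → ℕ
δ w h = if does (w ≟ h) then 1 else 0

evalPoly-δ : ∀ N {w} a → w < N → evalPoly (δ w) N a ≡ a ^ w
evalPoly-δ (suc N) {zero}  a _           = cong (1 +_) (trans (cong (a *_) (evalPoly-zero N a)) (*-zeroʳ a))
evalPoly-δ (suc N) {suc w} a (s≤s w<N) = cong (a *_) (evalPoly-δ N a w<N)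

coefficient≤evalPoly-1 : ∀ N (c : ℕ → ℕ) {h} → h < N → c h ≤ evalPoly c N 1
coefficient≤evalPoly-1 (suc N) c {zero}  _         = m≤m+n (c 0) _
coefficient≤evalPoly-1 (suc N) c {suc h} (s≤s h<N) =
  ≤-trans (coefficient≤evalPoly-1 N (c ∘ suc) h<N)
          (≤-trans (≤-reflexive (sym (*-identityˡ _))) (m≤n+m _ (c 0)))

base-digit-unique : ∀ {a c₀ d₀ X Y} → c₀ < a → d₀ < a → c₀ + a * X ≡ d₀ + a * Y →
  c₀ ≡ d₀ × X ≡ Y
base-digit-unique {a@(suc _)} {c₀} {d₀} {X} {Y} c₀<a d₀<a eq = c₀≡d₀ , X≡Y
  where
  last-digit : ∀ {e Z} → e < a → (e + a * Z) % a ≡ e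
  last-digit {e} {Z} e<a = begin
    (e + a * Z) % a  ≡⟨ cong (λ m → (e + m) % a) (*-comm a Z) ⟩
    (e + Z * a) % a  ≡⟨ [m+kn]%n≡m%n e Z a ⟩
    e % a            ≡⟨ m<n⇒m%n≡m e<a ⟩
    e                ∎
  c₀≡d₀ : c₀ ≡ d₀
  c₀≡d₀ = trans (sym (last-digit c₀<a)) (trans (cong (_% a) eq) (last-digit d₀<a))
  X≡Y : X ≡ Y
  X≡Y = *-cancelˡ-≡ X Y a (+-cancelˡ-≡ d₀ _ _ (trans (cong (_+ a * X) (sym c₀≡d₀)) eq))

evalPoly-injective : ∀ N {a} {c d : ℕ → ℕ} →
  (∀ h → h < N → c h < a) → (∀ h → h < N → d h < a) →
  evalPoly c N a ≡ evalPoly d N a → ∀ h → h < N → c h ≡ d h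
evalPoly-injective (suc N) c<a d<a eq h h<N
  with base-digit-unique (c<a 0 (s≤s z≤n)) (d<a 0 (s≤s z≤n)) eq
evalPoly-injective (suc N) c<a d<a eq zero    _         | c₀≡d₀ , _ = c₀≡d₀
evalPoly-injective (suc N) c<a d<a eq (suc h) (s≤s h<N) | _ , rest≡ =
  evalPoly-injective N (λ h → c<a (suc h) ∘ s≤s) (λ h → d<a (suc h) ∘ s≤s) rest≡ h h<N

evalPoly-coefficients-unique : ∀ N (c d : ℕ → ℕ) →
  (∀ a → evalPoly c N a ≡ evalPoly d N a) → ∀ h → h < N → c h ≡ d h
evalPoly-coefficients-unique N c d same =
  evalPoly-injective N c<base d<base (same base)
  where
  base : ℕ
  base = suc (evalPoly c N 1 + evalPoly d N 1)
  c<base : ∀ h → h < N → c h < base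
  c<base h h<N = s≤s (≤-trans (coefficient≤evalPoly-1 N c h<N) (m≤m+n _ _))
  d<base : ∀ h → h < N → d h < base
  d<base h h<N = s≤s (≤-trans (coefficient≤evalPoly-1 N d h<N) (m≤n+m _ _))

shift : (ℕ → ℕ) → ℕ → ℕ
shift c zero    = 0
shift c (suc h) = c h

pascal : ∀ k h → suc k C h ≡ k C h + shift (k C_) h
pascal k zero    = refl
pascal k (suc h) = trans (sym (nCk+nC[k+1]≡[n+1]C[k+1] k h)) (+-comm (k C h) _)

binomial-evalPoly : ∀ {k N} a → k ≤ N → suc a ^ k ≡ evalPoly (k C_) (suc N) a
binomial-evalPoly {zero}  {N}     a _ = sym (cong (1 +_) (trans (cong (a *_) (evalPoly-zero N a)) (*-zeroʳ a)))
binomial-evalPoly {suc k} {suc N} a (s≤s k≤N) = begin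
  suc a ^ k + a * suc a ^ k
    ≡⟨ cong₂ _+_ (binomial-evalPoly a (m≤n⇒m≤1+n k≤N)) (cong (a *_) (binomial-evalPoly a k≤N)) ⟩
  evalPoly (k C_) (suc (suc N)) a + evalPoly (shift (k C_)) (suc (suc N)) a
    ≡⟨ evalPoly-+ (suc (suc N)) (k C_) (shift (k C_)) a ⟨
  evalPoly (λ h → k C h + shift (k C_) h) (suc (suc N)) a
    ≡⟨ evalPoly-cong (suc (suc N)) a (sym ∘ pascal k) ⟩
  evalPoly (suc k C_) (suc (suc N)) a ∎

weightCount-∷ : ∀ {n} (s : Subcube n) (F : List (Subcube n)) h →
  weightCount (s ∷ F) h ≡ δ (weight s) h + weightCount F h
weightCount-∷ s F h with weight s ≡ᵇ h
... | true  = refl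
... | false = refl

sumList-^weight≡evalPoly-weightCount : ∀ {n} N a (F : List (Subcube n)) →
  (∀ s → s ∈ F → weight s < N) → sumList F (λ s → a ^ weight s) ≡ evalPoly (weightCount F) N a
sumList-^weight≡evalPoly-weightCount N a []      _ = sym (evalPoly-zero N a)
sumList-^weight≡evalPoly-weightCount N a (s ∷ F) weight<N = begin
  a ^ weight s + sumList F (λ t → a ^ weight t)
    ≡⟨ cong₂ _+_ (sym (evalPoly-δ N a (weight<N s (here refl))))
                 (sumList-^weight≡evalPoly-weightCount N a F (λ t → weight<N t ∘ there)) ⟩
  evalPoly (δ (weight s)) N a + evalPoly (weightCount F) N a
    ≡⟨ evalPoly-+ N (δ (weight s)) (weightCount F) a ⟨
  evalPoly (λ h → δ (weight s) h + weightCount F h) N a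
    ≡⟨ evalPoly-cong N a (sym ∘ weightCount-∷ s F) ⟩
  evalPoly (weightCount (s ∷ F)) N a ∎

weight≤length : ∀ {n} (s : Subcube n) → weight s ≤ n
weight≤length []         = z≤n
weight≤length (s0 ∷ s)   = m≤n⇒m≤1+n (weight≤length s)
weight≤length (s1 ∷ s)   = s≤s (weight≤length s)
weight≤length (star ∷ s) = m≤n⇒m≤1+n (weight≤length s)

lemma2p54 : (n k : ℕ) → 1 ≤ k → k ≤ n → (F : List (Subcube n)) →
    IsHomogeneous n k F →
    (h : Fin (suc n)) → weightVector F h ≡ k C toℕ h
lemma2p54 n k _ k≤n F (partition , _ , codim≡k) h =
  evalPoly-coefficients-unique (suc n) (weightCount F) (k C_) same-values (toℕ h) (Finₚ.toℕ<n h)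
  where
  same-values : ∀ a → evalPoly (weightCount F) (suc n) a ≡ evalPoly (k C_) (suc n) a
  same-values a = begin
    evalPoly (weightCount F) (suc n) a
      ≡⟨ sumList-^weight≡evalPoly-weightCount (suc n) a F (λ s _ → s≤s (weight≤length s)) ⟨
    sumList F (λ s → a ^ weight s)
      ≡⟨ homogeneous⇒weightEnumerator F partition codim≡k a ⟩
    suc a ^ k
      ≡⟨ binomial-evalPoly a k≤n ⟩
    evalPoly (k C_) (suc n) a ∎
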